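{- Let $k\ge 2$ and $n\ge 1$ be integers. For every integer $\ell$ with $1\le \ell\le n-1$, \[F^{(k)}_n=\sum_{j=0}^{k-1}F^{(k)}_{\ell-j}\left(\sum_{i=0}^{k-1-j}F^{(k)}_{n-\ell-i}\right).\]
   Context: For an integer $k\ge 2$, the $k$-generalized Fibonacci sequence $(F^{(k)}_n)_{n\ge -(k-2)}$ is defined by $F^{(k)}_{ -k+2}=\cdots=F^{(k)}_0=0$, $F^{(k)}_1=1$, and $F^{(k)}_{n+k}=F^{(k)}_{n+k-1}+F^{(k)}_{n+k-2}+\cdots+F^{(k)}_n$ for $n\ge 0$. -}

module Defs where

open import Data.Nat using (ℕ; zero; suc; _+_; _∸_)
open import Data.Integer using (ℤ; +_; -[1+_]; _-_)
open import Data.List using (List; []; _∷_; take)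
open import Data.Nat.ListAction using (sum)

-- fibs k m = [F_m, F_{m-1}, ..., F_1, F_0]  (k-generalized Fibonacci, indices ≥ 0)
fibs : ℕ → ℕ → List ℕ
fibs k zero = 0 ∷ []
fibs k (suc zero) = 1 ∷ 0 ∷ []
fibs k (suc (suc m)) = let xs = fibs k (suc m) in sum (take k xs) ∷ xs
-- F_{m+2} = F_{m+1} + ... + F_{m+2-k}, where terms with index ≤ 0 are 0
-- (matching F_{-k+2} = ... = F_0 = 0).

headℕ : List ℕ → ℕ
headℕ [] = 0
headℕ (x ∷ _) = x

Fibℕ : ℕ → ℕ → ℕ
Fibℕ k m = headℕ (fibs k m)

-- k-generalized Fibonacci on integer indices; F^{(k)}_n = 0 for n ≤ 0
-- (in particular for -(k-2) ≤ n ≤ 0, the range where the paper defines it)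
F : ℕ → ℤ → ℕ
F k (+ m) = Fibℕ k m
F k -[1+ _ ] = 0

Σ< : ℕ → (ℕ → ℕ) → ℕ
Σ< zero f = 0
Σ< (suc m) f = Σ< m f + f m

-- Write T(ℓ, m) for the right-hand side with n = ℓ + m. Splitting off the
-- j = 0 term and expanding F_{ℓ+1} by the recurrence gives
-- T(ℓ + 1, m) = T(ℓ, m + 1) for ℓ, m ≥ 1, the tail sums regrouping because
-- Σ_{i<k-j} F_{m+1-i} = F_{m+1} + Σ_{i<k-j-1} F_{m-i}. As T(1, m) is the
-- recurrence for F_{m+1}, induction on ℓ yields T(ℓ, m) = F_{ℓ+m}.
module Submission where

open import Defs
open import Data.Nat using (ℕ; _≤_; _<_; _∸_; _*_; _+_; zero; suc; z≤n; s≤s)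
open import Data.Nat.Properties
  using (+-assoc; +-comm; +-suc; +-identityʳ; *-zeroʳ; *-identityˡ; *-distribʳ-+; *-distribˡ-+;
         +-commutativeSemigroup; +-∸-assoc; n∸n≡0; m+[n∸m]≡n; m<n⇒0<n∸m; n<1+n; m<n⇒m<1+n; <⇒≤)
open import Data.Nat.ListAction using (sum)
open import Data.Integer using (+_; _-_; _⊖_)
open import Data.Integer.Properties using ([1+m]⊖[1+n]≡m⊖n; ⊖-≥; ⊖-<; m-n≡m⊖n)
open import Data.List using (take; _∷_)
open import Data.List.Properties using (take-[])
open import Algebra.Properties.CommutativeSemigroup +-commutativeSemigroup using (interchange)
open import Relation.Binary.PropositionalEquality using (_≡_; refl; sym; trans; cong; cong₂)
open Relation.Binary.PropositionalEquality.≡-Reasoning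

Σ<-cong : ∀ m {f g : ℕ → ℕ} → (∀ j → j < m → f j ≡ g j) → Σ< m f ≡ Σ< m g
Σ<-cong zero    f≡g = refl
Σ<-cong (suc m) f≡g =
  cong₂ _+_ (Σ<-cong m (λ j j<m → f≡g j (m<n⇒m<1+n j<m))) (f≡g m (n<1+n m))

Σ<-zero : ∀ m {f : ℕ → ℕ} → (∀ j → f j ≡ 0) → Σ< m f ≡ 0
Σ<-zero zero    f≡0 = refl
Σ<-zero (suc m) f≡0 = cong₂ _+_ (Σ<-zero m f≡0) (f≡0 m)

Σ<-head : ∀ m (f : ℕ → ℕ) → Σ< (suc m) f ≡ f 0 + Σ< m (λ j → f (suc j))
Σ<-head zero    f = +-comm 0 (f 0)
Σ<-head (suc m) f = trans (cong (_+ f (suc m)) (Σ<-head m f)) (+-assoc (f 0) _ _)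

Σ<-+ : ∀ m (f g : ℕ → ℕ) → Σ< m (λ j → f j + g j) ≡ Σ< m f + Σ< m g
Σ<-+ zero    f g = refl
Σ<-+ (suc m) f g = trans (cong (_+ (f m + g m)) (Σ<-+ m f g)) (interchange (Σ< m f) (Σ< m g) (f m) (g m))

Σ<-*ʳ : ∀ m (f : ℕ → ℕ) c → Σ< m f * c ≡ Σ< m (λ j → f j * c)
Σ<-*ʳ zero    f c = refl
Σ<-*ʳ (suc m) f c = trans (*-distribʳ-+ c (Σ< m f) (f m)) (cong (_+ f m * c) (Σ<-*ʳ m f c))

module KFibonacci (k : ℕ) where

  fib : ℕ → ℕ
  fib = Fibℕ k

  F[_⊖_] : ℕ → ℕ → ℕ
  F[ a ⊖ b ] = F k (a ⊖ b)

  F[suc⊖suc] : ∀ a b → F[ suc a ⊖ suc b ] ≡ F[ a ⊖ b ]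
  F[suc⊖suc] a b = cong (F k) ([1+m]⊖[1+n]≡m⊖n a b)

  F[⊖zero] : ∀ a → F[ a ⊖ 0 ] ≡ fib a
  F[⊖zero] a = cong (F k) (⊖-≥ (z≤n {a}))

  F[zero⊖] : ∀ b → F[ 0 ⊖ b ] ≡ 0
  F[zero⊖] zero    = refl
  F[zero⊖] (suc b) = cong (F k) (⊖-< (s≤s (z≤n {b})))

  fibs-suc : ∀ m → fibs k (suc m) ≡ fib (suc m) ∷ fibs k m
  fibs-suc zero    = refl
  fibs-suc (suc m) = refl

  sum-take-fibs : ∀ j m → sum (take j (fibs k m)) ≡ Σ< j (λ i → F[ m ⊖ i ])
  sum-take-fibs zero    m = refl
  sum-take-fibs (suc j) zero = trans (cong sum (take-[] j)) (sym (Σ<-zero (suc j) F[zero⊖]))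
  sum-take-fibs (suc j) (suc m) = begin
    sum (take (suc j) (fibs k (suc m)))               ≡⟨ cong (λ xs → sum (take (suc j) xs)) (fibs-suc m) ⟩
    fib (suc m) + sum (take j (fibs k m))             ≡⟨ cong₂ _+_ (sym (F[⊖zero] (suc m))) (sum-take-fibs j m) ⟩
    F[ suc m ⊖ 0 ] + Σ< j (λ i → F[ m ⊖ i ])          ≡⟨ cong (λ s → F[ suc m ⊖ 0 ] + s) (Σ<-cong j (λ i _ → sym (F[suc⊖suc] m i))) ⟩
    F[ suc m ⊖ 0 ] + Σ< j (λ i → F[ suc m ⊖ suc i ])  ≡⟨ sym (Σ<-head j (λ i → F[ suc m ⊖ i ])) ⟩
    Σ< (suc j) (λ i → F[ suc m ⊖ i ])                 ∎

  fib-recurrence : ∀ m → fib (suc (suc m)) ≡ Σ< k (λ i → F[ suc m ⊖ i ])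
  fib-recurrence m = sum-take-fibs k (suc m)

  window : ℕ → ℕ → ℕ
  window j m = Σ< (k ∸ j) (λ i → F[ m ⊖ i ])

  convolution : ℕ → ℕ → ℕ
  convolution ℓ m = Σ< k (λ j → F[ ℓ ⊖ j ] * window j m)

  window-suc : ∀ {j} m → j < k → window j (suc m) ≡ fib (suc m) + window (suc j) m
  window-suc {j} m j<k = begin
    Σ< (k ∸ j) (λ i → F[ suc m ⊖ i ])                       ≡⟨ cong (λ r → Σ< r (λ i → F[ suc m ⊖ i ])) (+-∸-assoc 1 j<k) ⟩
    Σ< (suc (k ∸ suc j)) (λ i → F[ suc m ⊖ i ])             ≡⟨ Σ<-head (k ∸ suc j) _ ⟩
    F[ suc m ⊖ 0 ] + Σ< (k ∸ suc j) (λ i → F[ suc m ⊖ suc i ]) ≡⟨ cong₂ _+_ (F[⊖zero] (suc m)) (Σ<-cong (k ∸ suc j) (λ i _ → F[suc⊖suc] m i)) ⟩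
    fib (suc m) + window (suc j) m                          ∎

  window-k : ∀ m → window k m ≡ 0
  window-k m = cong (λ r → Σ< r (λ i → F[ m ⊖ i ])) (n∸n≡0 k)

  convolution-statement : ∀ {ℓ n} → ℓ ≤ n →
    Σ< k (λ j → F k (+ ℓ - + j) * Σ< (k ∸ j) (λ i → F k (+ n - + ℓ - + i)))
      ≡ convolution ℓ (n ∸ ℓ)
  convolution-statement {ℓ} {n} ℓ≤n =
    Σ<-cong k (λ j _ → cong₂ _*_ (cong (F k) (m-n≡m⊖n ℓ j))
                                 (Σ<-cong (k ∸ j) (λ i _ → cong (F k) (n-ℓ-i i))))
    where
    n-ℓ-i : ∀ i → + n - + ℓ - + i ≡ (n ∸ ℓ) ⊖ i
    n-ℓ-i i = begin
      + n - + ℓ - + i     ≡⟨ cong (_- + i) (trans (m-n≡m⊖n n ℓ) (⊖-≥ ℓ≤n)) ⟩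
      + (n ∸ ℓ) - + i     ≡⟨ m-n≡m⊖n (n ∸ ℓ) i ⟩
      (n ∸ ℓ) ⊖ i         ∎

module Convolution (k′ : ℕ) where
  open KFibonacci (suc k′)

  convolution-one : ∀ m → convolution 1 (suc m) ≡ fib (suc (suc m))
  convolution-one m = begin
    convolution 1 (suc m)
      ≡⟨ Σ<-head k′ _ ⟩
    F[ 1 ⊖ 0 ] * window 0 (suc m) + Σ< k′ (λ j → F[ 1 ⊖ suc j ] * window (suc j) (suc m))
      ≡⟨ cong₂ _+_ (cong (_* window 0 (suc m)) (F[⊖zero] 1))
                   (Σ<-zero k′ (λ j → cong (_* window (suc j) (suc m)) (trans (F[suc⊖suc] 0 j) (F[zero⊖] j)))) ⟩
    1 * window 0 (suc m) + 0
      ≡⟨ trans (+-identityʳ _) (*-identityˡ _) ⟩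
    window 0 (suc m)
      ≡⟨ sym (fib-recurrence m) ⟩
    fib (suc (suc m)) ∎

  convolution-shift : ∀ ℓ m → convolution (suc (suc ℓ)) (suc m) ≡ convolution (suc ℓ) (suc (suc m))
  convolution-shift ℓ m = begin
    convolution (suc (suc ℓ)) (suc m)
      ≡⟨ Σ<-head k′ _ ⟩
    F[ suc (suc ℓ) ⊖ 0 ] * window 0 (suc m) + Σ< k′ (λ j → F[ suc (suc ℓ) ⊖ suc j ] * window (suc j) (suc m))
      ≡⟨ cong₂ _+_ (cong₂ _*_ (trans (F[⊖zero] (suc (suc ℓ))) (fib-recurrence ℓ)) (sym (fib-recurrence m)))
                   (Σ<-cong k′ (λ j _ → cong (_* window (suc j) (suc m)) (F[suc⊖suc] (suc ℓ) j))) ⟩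
    Σ< k (λ j → F[ suc ℓ ⊖ j ]) * fib (suc (suc m)) + Σ< k′ tail
      ≡⟨ cong₂ _+_ (Σ<-*ʳ k (λ j → F[ suc ℓ ⊖ j ]) (fib (suc (suc m)))) (sym last-term-vanishes) ⟩
    Σ< k (λ j → F[ suc ℓ ⊖ j ] * fib (suc (suc m))) + Σ< k tail
      ≡⟨ sym (Σ<-+ k _ tail) ⟩
    Σ< k (λ j → F[ suc ℓ ⊖ j ] * fib (suc (suc m)) + tail j)
      ≡⟨ Σ<-cong k (λ j j<k → trans (sym (*-distribˡ-+ F[ suc ℓ ⊖ j ] _ _))
                                    (cong (F[ suc ℓ ⊖ j ] *_) (sym (window-suc (suc m) j<k)))) ⟩
    convolution (suc ℓ) (suc (suc m)) ∎
    where
    k : ℕ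
    k = suc k′
    tail : ℕ → ℕ
    tail j = F[ suc ℓ ⊖ j ] * window (suc j) (suc m)
    last-term-vanishes : Σ< k tail ≡ Σ< k′ tail
    last-term-vanishes = begin
      Σ< k′ tail + F[ suc ℓ ⊖ k′ ] * window k (suc m)  ≡⟨ cong (λ w → Σ< k′ tail + F[ suc ℓ ⊖ k′ ] * w) (window-k (suc m)) ⟩
      Σ< k′ tail + F[ suc ℓ ⊖ k′ ] * 0                   ≡⟨ cong (λ t → Σ< k′ tail + t) (*-zeroʳ F[ suc ℓ ⊖ k′ ]) ⟩
      Σ< k′ tail + 0                                   ≡⟨ +-identityʳ (Σ< k′ tail) ⟩
      Σ< k′ tail                                       ∎

  convolution≡fib : ∀ ℓ m → convolution (suc ℓ) (suc m) ≡ fib (suc ℓ + suc m)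
  convolution≡fib zero    m = convolution-one m
  convolution≡fib (suc ℓ) m = begin
    convolution (suc (suc ℓ)) (suc m)     ≡⟨ convolution-shift ℓ m ⟩
    convolution (suc ℓ) (suc (suc m))     ≡⟨ convolution≡fib ℓ (suc m) ⟩
    fib (suc ℓ + suc (suc m))             ≡⟨ cong fib (+-suc (suc ℓ) (suc m)) ⟩
    fib (suc (suc ℓ) + suc m)             ∎

lemma3p3 : (k n ℓ : ℕ) → 2 ≤ k → 1 ≤ n → 1 ≤ ℓ → ℓ ≤ n ∸ 1 →
    F k (+ n) ≡
      Σ< k (λ j → F k (+ ℓ - + j) *
        Σ< (k ∸ j) (λ i → F k (+ n - + ℓ - + i)))
lemma3p3 k@(suc k′) n@(suc _) ℓ@(suc ℓ′) (s≤s _) _ _ ℓ≤n-1 = sym (begin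
  Σ< k (λ j → F k (+ ℓ - + j) * Σ< (k ∸ j) (λ i → F k (+ n - + ℓ - + i)))
    ≡⟨ convolution-statement (<⇒≤ ℓ<n) ⟩
  convolution ℓ (n ∸ ℓ)
    ≡⟨ cong (convolution ℓ) n-ℓ≡1+m ⟩
  convolution ℓ (suc m)
    ≡⟨ Convolution.convolution≡fib k′ ℓ′ m ⟩
  fib (ℓ + suc m)
    ≡⟨ cong fib (trans (cong (λ r → ℓ + r) (sym n-ℓ≡1+m)) (m+[n∸m]≡n (<⇒≤ ℓ<n))) ⟩
  fib n ∎)
  where
  open KFibonacci k
  ℓ<n : ℓ < n
  ℓ<n = s≤s ℓ≤n-1
  m : ℕ
  m = n ∸ ℓ ∸ 1
  n-ℓ≡1+m : n ∸ ℓ ≡ suc m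
  n-ℓ≡1+m = sym (m+[n∸m]≡n (m<n⇒0<n∸m ℓ<n))
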